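{- Let $E=\{0,1,\dots,n\}$, let $M$ be a loopless matroid on $E$, let $i\in E$, let $\ell$ be an integer and let $F$ be a nonempty proper flat of $M$. Then in $A^*(M)$: (1) if $|F|\le\ell$ and $i\in F$, then $\theta_i(\gamma_{\ell-1})x_F=\gamma_\ell x_F$; (2) if $|F|\ge\ell$ and $i\notin F$, then $\theta_i(\gamma_\ell)x_F=\gamma_\ell x_F$, where inside $\theta_i$ the classes are hypersimplex classes of $M\setminus i$ and outside they are hypersimplex classes of $M$.
   Context: For a loopless matroid $N$ on a finite ground set $U$, its Chow ring $A^*(N)$ (real coefficients) is $\mathbb{R}[x_G : G \text{ a nonempty proper flat of } N]$ modulo the ideal generated by all $x_{G_1}x_{G_2}$ with $G_1,G_2$ incomparable and all $\sum_{G\ni a}x_G-\sum_{G\ni b}x_G$ for $a,b\in U$. For $S\subseteq U$, $x_S$ means the generator if $S$ is a nonempty proper flat of $N$ and $0$ otherwise. The hypersimplex classes of $N$ are $\gamma_k=\sum_{S}\left(\min(|S|,k)-\frac{k}{|U|}|S|\right)x_S\in A^1(N)$ for $1\le k\le|U|-1$ (sum over nonempty proper $S\subsetneq U$) and $\gamma_k=0$ for $k\le0$ or $k\ge|U|$. $M\setminus i$ is the deletion, a matroid on $E\setminus\{i\}$. The pullback $\theta_i:A^*(M\setminus i)\to A^*(M)$ is the ring homomorphism with $\theta_i(x_G)=x_G+x_{G\cup\{i\}}$ for nonempty proper flats $G$ of $M\setminus i$ (terms interpreted in $A^*(M)$, zero if not a nonempty proper flat of $M$). -}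

module Defs where

open import Data.Nat as ℕ using (ℕ; zero; suc; _<_; _≤_; _⊓_)
open import Data.Nat.Properties using (_≤?_; _<?_)
open import Data.Integer as ℤ using (ℤ; +_; -[1+_])
open import Data.Rational as ℚ using (ℚ; 0ℚ; 1ℚ)
open import Data.Fin using (Fin)
open import Data.Fin.Subset
  using (Subset; _∈_; _∉_; _⊆_; _∪_; _∩_; ⁅_⁆; ∣_∣; Nonempty; inside; outside)
open import Data.Fin.Subset.Properties using (_∈?_; _⊆?_; nonempty?)
open import Data.Fin.Properties using (all?; any?)
open import Data.Vec using (Vec; []; _∷_)
open import Data.List using (List; []; _∷_; _++_; map; filter; foldr)
open import Data.Product using (_×_; ∃; Σ)
open import Data.Bool using (if_then_else_)
open import Relation.Binary.PropositionalEquality using (_≡_)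
open import Relation.Nullary using (¬_; Dec; yes; no; does)
open import Relation.Nullary.Decidable using (_×-dec_; _→-dec_; ¬?)

record Matroid (m : ℕ) : Set where
  field
    rank        : Subset m → ℕ
    rank-≤-card : ∀ X → rank X ≤ ∣ X ∣
    rank-mono   : ∀ {X Y} → X ⊆ Y → rank X ≤ rank Y
    rank-submod : ∀ X Y → rank (X ∪ Y) ℕ.+ rank (X ∩ Y) ≤ rank X ℕ.+ rank Y
open Matroid public

Loopless : ∀ {m} → Matroid m → Set
Loopless M = ∀ e → rank M ⁅ e ⁆ ≡ 1

-- A matroid with ground set U ⊆ Fin m whose rank function is the
-- restriction of r to subsets of U.  For M itself U = ⊤; for the
-- deletion M \ i, U = ⊤ ─ ⁅ i ⁆ and r = rank M (rank of a deletion is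
-- the restriction of the rank function).

IsFlat : ∀ {m} → Subset m → (Subset m → ℕ) → Subset m → Set
IsFlat U r G = G ⊆ U × (∀ e → e ∈ U → e ∉ G → r G < r (G ∪ ⁅ e ⁆))

IsNPFlat : ∀ {m} → Subset m → (Subset m → ℕ) → Subset m → Set
IsNPFlat U r G = Nonempty G × ∃ (λ e → e ∈ U × e ∉ G) × IsFlat U r G

isNPFlat? : ∀ {m} (U : Subset m) (r : Subset m → ℕ) (G : Subset m) →
            Dec (IsNPFlat U r G)
isNPFlat? U r G =
  nonempty? G ×-dec
  (any? (λ e → (e ∈? U) ×-dec ¬? (e ∈? G)) ×-dec
  ((G ⊆? U) ×-dec
   all? (λ e → (e ∈? U) →-dec (¬? (e ∈? G) →-dec (r G <? r (G ∪ ⁅ e ⁆))))))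

subsetsOf : ∀ {m} → Subset m → List (Subset m)
subsetsOf [] = [] ∷ []
subsetsOf (outside ∷ U) = map (outside ∷_) (subsetsOf U)
subsetsOf (inside ∷ U) =
  map (outside ∷_) (subsetsOf U) ++ map (inside ∷_) (subsetsOf U)

infixl 6 _⊕_
infixl 7 _⊗_
infix  8 ⊖_

data Expr (m : ℕ) : Set where
  var : Subset m → Expr m
  con : ℚ → Expr m
  _⊕_ : Expr m → Expr m → Expr m
  _⊗_ : Expr m → Expr m → Expr m
  ⊖_  : Expr m → Expr m

ΣE : ∀ {m} {A : Set} → List A → (A → Expr m) → Expr m
ΣE xs f = foldr (λ a acc → f a ⊕ acc) (con 0ℚ) xs

-- Expr m / ≈⟨ R ⟩ is ℚ[x_S]/(R).
infix 4 _≈⟨_⟩_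
data _≈⟨_⟩_ {m : ℕ} : Expr m → (Expr m → Set) → Expr m → Set₁ where
  ≈-refl  : ∀ {R x} → x ≈⟨ R ⟩ x
  ≈-sym   : ∀ {R x y} → x ≈⟨ R ⟩ y → y ≈⟨ R ⟩ x
  ≈-trans : ∀ {R x y z} → x ≈⟨ R ⟩ y → y ≈⟨ R ⟩ z → x ≈⟨ R ⟩ z
  ⊕-cong  : ∀ {R x y u v} → x ≈⟨ R ⟩ y → u ≈⟨ R ⟩ v → x ⊕ u ≈⟨ R ⟩ y ⊕ v
  ⊗-cong  : ∀ {R x y u v} → x ≈⟨ R ⟩ y → u ≈⟨ R ⟩ v → x ⊗ u ≈⟨ R ⟩ y ⊗ v
  ⊖-cong  : ∀ {R x y} → x ≈⟨ R ⟩ y → ⊖ x ≈⟨ R ⟩ ⊖ y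
  ⊕-assoc : ∀ {R x y z} → (x ⊕ y) ⊕ z ≈⟨ R ⟩ x ⊕ (y ⊕ z)
  ⊕-comm  : ∀ {R x y} → x ⊕ y ≈⟨ R ⟩ y ⊕ x
  ⊕-idˡ   : ∀ {R x} → con 0ℚ ⊕ x ≈⟨ R ⟩ x
  ⊖-invˡ  : ∀ {R x} → ⊖ x ⊕ x ≈⟨ R ⟩ con 0ℚ
  ⊗-assoc : ∀ {R x y z} → (x ⊗ y) ⊗ z ≈⟨ R ⟩ x ⊗ (y ⊗ z)
  ⊗-comm  : ∀ {R x y} → x ⊗ y ≈⟨ R ⟩ y ⊗ x
  ⊗-idˡ   : ∀ {R x} → con 1ℚ ⊗ x ≈⟨ R ⟩ x
  distribˡ : ∀ {R x y z} → x ⊗ (y ⊕ z) ≈⟨ R ⟩ (x ⊗ y) ⊕ (x ⊗ z)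
  con-+   : ∀ {R p q} → con p ⊕ con q ≈⟨ R ⟩ con (p ℚ.+ q)
  con-*   : ∀ {R p q} → con p ⊗ con q ≈⟨ R ⟩ con (p ℚ.* q)
  rel     : ∀ {R x} → R x → x ≈⟨ R ⟩ con 0ℚ

ΣFlatsContaining : ∀ {m} → Subset m → (Subset m → ℕ) → Fin m → Expr m
ΣFlatsContaining U r a =
  ΣE (filter (λ G → isNPFlat? U r G ×-dec (a ∈? G)) (subsetsOf U)) var

data ChowRel {m : ℕ} (U : Subset m) (r : Subset m → ℕ) : Expr m → Set where
  nonflat : ∀ {S} → ¬ IsNPFlat U r S → ChowRel U r (var S)
  incomp  : ∀ {G₁ G₂} → IsNPFlat U r G₁ → IsNPFlat U r G₂ →
            ¬ G₁ ⊆ G₂ → ¬ G₂ ⊆ G₁ → ChowRel U r (var G₁ ⊗ var G₂)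
  linear  : ∀ {a b} → a ∈ U → b ∈ U →
            ChowRel U r (ΣFlatsContaining U r a ⊕ ⊖ ΣFlatsContaining U r b)

infix 4 _≈A⟨_,_⟩_
_≈A⟨_,_⟩_ : ∀ {m} → Expr m → Subset m → (Subset m → ℕ) → Expr m → Set₁
x ≈A⟨ U , r ⟩ y = x ≈⟨ ChowRel U r ⟩ y

coef : (k s u : ℕ) → ℚ
coef k s zero    = 0ℚ
coef k s (suc u) = ((+ (s ⊓ k)) ℚ./ 1) ℚ.- ((+ (k ℕ.* s)) ℚ./ suc u)

γ : ∀ {m} → Subset m → ℤ → Expr m
γ U -[1+ k ] = con 0ℚ
γ U (+ k) =
  if does (1 ≤? k) Data.Bool.∧ does (suc k ≤? ∣ U ∣)
  then ΣE (filter (λ S → (1 ≤? ∣ S ∣) ×-dec (suc ∣ S ∣ ≤? ∣ U ∣)) (subsetsOf U))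
          (λ S → con (coef k ∣ S ∣ ∣ U ∣) ⊗ var S)
  else con 0ℚ
  where import Data.Bool

-- Pullback θ_i : A*(M \ i) → A*(M), on representatives.
-- (U , r) is M; the deletion M \ i is (U ─ ⁅ i ⁆ , r).

θ : ∀ {m} → Subset m → (Subset m → ℕ) → Fin m → Expr m → Expr m
θ U r i (var G) with isNPFlat? (U Data.Fin.Subset.─ ⁅ i ⁆) r G
... | yes _ = var G ⊕ var (G ∪ ⁅ i ⁆)
... | no  _ = con 0ℚ
θ U r i (con q) = con q
θ U r i (x ⊕ y) = θ U r i x ⊕ θ U r i y
θ U r i (x ⊗ y) = θ U r i x ⊗ θ U r i y
θ U r i (⊖ x)   = ⊖ θ U r i x

{-# OPTIONS --safe #-}
-- Everything is brought into the normal form ∑_T c(T) x_T over subsets T ⊆ E.  Since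
-- θ_i(x_G) = x_G + x_{G ∪ i}, the coefficient of x_T in θ_i(γ) is the hypersimplex
-- coefficient of M ∖ i at T or at T - i.  Multiplying by x_F kills every x_T with T not a
-- flat comparable with F, and on comparable flats the size hypotheses on F make the two
-- coefficient families differ by a constant multiple of |T| - |E|·[i ∈ T].  This last family
-- contributes nothing: ∑_T (|T| - |E|·[i ∈ T]) x_T is the sum over a ∈ E of the linear
-- relators ∑_{G ∋ a} x_G - ∑_{G ∋ i} x_G.
module Submission where

open import Defs hiding (_≈⟨_⟩_)
import Defs
import Algebra.Consequences.Setoid
import Algebra.Properties.CommutativeSemigroup
import Algebra.Properties.Group
open import Algebra.Bundles using (CommutativeRing)
open import Algebra.Structures using (IsCommutativeRing)
open import Data.Bool using (Bool; true; false; not; _∧_; if_then_else_)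
open import Data.Empty using (⊥-elim)
open import Data.Fin using (Fin; zero; suc)
open import Data.Fin.Properties using (any?)
open import Data.Fin.Subset
  using (Subset; inside; outside; ⊤; ⊥; _∈_; _∉_; _⊆_; _∪_; _∩_; _─_; _-_; ⁅_⁆; ∣_∣; Nonempty)
import Data.Fin.Subset.Properties as Sub
open import Data.Integer as ℤ using (ℤ; +_; -[1+_])
import Data.Integer.Properties as ℤₚ
open import Data.List using (List; []; _∷_; _++_; map; filter)
open import Data.Nat as ℕ using (ℕ; zero; suc; _⊓_; z≤n; s≤s)
open import Data.Nat.Properties using (_≤?_)
import Data.Nat.Properties as ℕₚ
open import Data.Product using (_×_; _,_; ∃)
open import Data.Rational as ℚ using (ℚ; 0ℚ; 1ℚ; toℚᵘ)
import Data.Rational.Properties as ℚₚ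
open import Data.Rational.Solver using (module +-*-Solver)
open import Data.Rational.Unnormalised using (mkℚᵘ; *≡*) renaming (_≃_ to _≃ᵘ_)
import Data.Rational.Unnormalised.Properties as ℚᵘₚ
open import Data.Sum using (_⊎_; inj₁; inj₂; [_,_]′)
open import Data.Vec using (_∷_; []; lookup)
import Data.Vec.Properties as Vecₚ
open import Level using (0ℓ) renaming (suc to lsuc)
open import Relation.Binary.Bundles using (Setoid)
open import Relation.Binary.PropositionalEquality
  using (_≡_; _≢_; refl; sym; trans; cong; cong₂; subst; module ≡-Reasoning)
import Relation.Binary.Reasoning.Setoid
open import Relation.Nullary using (Dec; yes; no; does; ¬_)
open import Relation.Nullary.Decidable using (_×-dec_; ¬?)
open import Relation.Unary using (Pred; Decidable)

ι : ℕ → ℚ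
ι a = + a ℚ./ 1

1/[1+_] : ℕ → ℚ
1/[1+ u ] = + 1 ℚ./ suc u

module _ where
  open ℚᵘₚ using (≃-trans; ≃-sym)

  private
    toℚᵘ-/ : ∀ a u → toℚᵘ (a ℚ./ suc u) ≃ᵘ mkℚᵘ a u
    toℚᵘ-/ a u = ℚₚ.toℚᵘ-fromℚᵘ (mkℚᵘ a u)

  /-suc : ∀ a u → + a ℚ./ suc u ≡ ι a ℚ.* 1/[1+ u ]
  /-suc a u = ℚₚ.toℚᵘ-injective
    (≃-trans (toℚᵘ-/ (+ a) u) (≃-sym (≃-trans (ℚₚ.toℚᵘ-homo-* (ι a) 1/[1+ u ])
      (≃-trans (ℚᵘₚ.*-cong (toℚᵘ-/ (+ a) 0) (toℚᵘ-/ (+ 1) u)) (*≡* eq)))))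
    where
    eq : (+ a ℤ.* + 1) ℤ.* + suc u ≡ + a ℤ.* + suc (u ℕ.+ 0)
    eq rewrite ℕₚ.+-identityʳ u | ℤₚ.*-identityʳ (+ a) = refl

  ι-+ : ∀ a b → ι (a ℕ.+ b) ≡ ι a ℚ.+ ι b
  ι-+ a b = ℚₚ.toℚᵘ-injective
    (≃-trans (toℚᵘ-/ (+ (a ℕ.+ b)) 0) (≃-sym (≃-trans (ℚₚ.toℚᵘ-homo-+ (ι a) (ι b))
      (≃-trans (ℚᵘₚ.+-cong (toℚᵘ-/ (+ a) 0) (toℚᵘ-/ (+ b) 0)) (*≡* eq)))))
    where
    eq : (+ a ℤ.* + 1 ℤ.+ + b ℤ.* + 1) ℤ.* + 1 ≡ + (a ℕ.+ b) ℤ.* + 1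
    eq rewrite ℤₚ.*-identityʳ (+ a) | ℤₚ.*-identityʳ (+ b) | ℤₚ.*-identityʳ (+ a ℤ.+ + b) = refl

  ι-* : ∀ a b → ι (a ℕ.* b) ≡ ι a ℚ.* ι b
  ι-* a b = ℚₚ.toℚᵘ-injective
    (≃-trans (toℚᵘ-/ (+ (a ℕ.* b)) 0) (≃-sym (≃-trans (ℚₚ.toℚᵘ-homo-* (ι a) (ι b))
      (≃-trans (ℚᵘₚ.*-cong (toℚᵘ-/ (+ a) 0) (toℚᵘ-/ (+ b) 0)) (*≡* eq)))))
    where
    eq : (+ a ℤ.* + b) ℤ.* + 1 ≡ + (a ℕ.* b) ℤ.* + 1
    eq = cong (ℤ._* + 1) (sym (ℤₚ.pos-* a b))

  ι-suc : ∀ a → ι (suc a) ≡ 1ℚ ℚ.+ ι a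
  ι-suc = ι-+ 1

  ι-*-1/[1+] : ∀ u → ι (suc u) ℚ.* 1/[1+ u ] ≡ 1ℚ
  ι-*-1/[1+] u = trans (sym (/-suc (suc u) u)) (ℚₚ.toℚᵘ-injective
    (≃-trans (toℚᵘ-/ (+ suc u) u) (*≡* (cong +_ (ℕₚ.*-comm (suc u) 1)))))

coef-suc : ∀ k s u → coef k s (suc u) ≡ ι (s ⊓ k) ℚ.- ι k ℚ.* ι s ℚ.* 1/[1+ u ]
coef-suc k s u =
  cong (λ z → ι (s ⊓ k) ℚ.- z) (trans (/-suc (k ℕ.* s) u) (cong (ℚ._* 1/[1+ u ]) (ι-* k s)))

coef-zeroˡ : ∀ s u → coef 0 s u ≡ 0ℚ
coef-zeroˡ s zero    = refl
coef-zeroˡ s (suc u) = begin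
  coef 0 s (suc u)                 ≡⟨ coef-suc 0 s u ⟩
  ι (s ⊓ 0) ℚ.- 0ℚ ℚ.* S ℚ.* W     ≡⟨ cong (λ z → ι z ℚ.- 0ℚ ℚ.* S ℚ.* W) (ℕₚ.⊓-zeroʳ s) ⟩
  0ℚ ℚ.- 0ℚ ℚ.* S ℚ.* W            ≡⟨ solve 2 (λ S W → con 0ℚ :- con 0ℚ :* S :* W := con 0ℚ) refl S W ⟩
  0ℚ                               ∎
  where
  open ≡-Reasoning
  open +-*-Solver
  S = ι s; W = 1/[1+ u ]

coef-zeroʳ : ∀ k u → coef k 0 u ≡ 0ℚ
coef-zeroʳ k zero    = refl
coef-zeroʳ k (suc u) = trans (coef-suc k 0 u)
  (solve 2 (λ K W → con 0ℚ :- K :* con 0ℚ :* W := con 0ℚ) refl (ι k) 1/[1+ u ])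
  where open +-*-Solver

coef-full : ∀ k u → k ℕ.≤ u → coef k u u ≡ 0ℚ
coef-full k zero    _   = refl
coef-full k (suc u) k≤u = begin
  coef k (suc u) (suc u)           ≡⟨ coef-suc k (suc u) u ⟩
  ι (suc u ⊓ k) ℚ.- K ℚ.* N ℚ.* W  ≡⟨ cong (λ z → ι z ℚ.- K ℚ.* N ℚ.* W) (ℕₚ.m≥n⇒m⊓n≡n k≤u) ⟩
  K ℚ.- K ℚ.* N ℚ.* W              ≡⟨ cong (λ z → K ℚ.- z) (ℚₚ.*-assoc K N W) ⟩
  K ℚ.- K ℚ.* (N ℚ.* W)            ≡⟨ cong (λ z → K ℚ.- K ℚ.* z) (ι-*-1/[1+] u) ⟩
  K ℚ.- K ℚ.* 1ℚ                   ≡⟨ solve 1 (λ K → K :- K :* con 1ℚ := con 0ℚ) refl K ⟩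
  0ℚ                               ∎
  where
  open ≡-Reasoning
  open +-*-Solver
  K = ι k; N = ι (suc u); W = 1/[1+ u ]

coef-top : ∀ s u → s ℕ.≤ u → coef u s u ≡ 0ℚ
coef-top s zero    _   = refl
coef-top s (suc u) s≤u = begin
  coef (suc u) s (suc u)           ≡⟨ coef-suc (suc u) s u ⟩
  ι (s ⊓ suc u) ℚ.- N ℚ.* S ℚ.* W  ≡⟨ cong (λ z → ι z ℚ.- N ℚ.* S ℚ.* W) (ℕₚ.m≤n⇒m⊓n≡m s≤u) ⟩
  S ℚ.- N ℚ.* S ℚ.* W              ≡⟨ solve 3 (λ S N W → S :- N :* S :* W := S :- S :* (N :* W)) refl S N W ⟩
  S ℚ.- S ℚ.* (N ℚ.* W)            ≡⟨ cong (λ z → S ℚ.- S ℚ.* z) (ι-*-1/[1+] u) ⟩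
  S ℚ.- S ℚ.* 1ℚ                   ≡⟨ solve 1 (λ S → S :- S :* con 1ℚ := con 0ℚ) refl S ⟩
  0ℚ                               ∎
  where
  open ≡-Reasoning
  open +-*-Solver
  S = ι s; N = ι (suc u); W = 1/[1+ u ]

coef-degenerate : ∀ k s u → k ℕ.≤ u → s ℕ.≤ u → ¬ (1 ℕ.≤ s × suc s ℕ.≤ u) → coef k s u ≡ 0ℚ
coef-degenerate k zero    u k≤u _   _ = coef-zeroʳ k u
coef-degenerate k (suc s) u k≤u s≤u ¬proper = subst (λ s → coef k s u ≡ 0ℚ) (sym s≡u) (coef-full k u k≤u)
  where s≡u = ℕₚ.≤-antisym s≤u (ℕₚ.≮⇒≥ (λ s<u → ¬proper (s≤s z≤n , s<u)))

shift : ℕ → ℕ → ℕ → ℚ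
shift u k k′ = ι k′ ℚ.* 1/[1+ suc u ] ℚ.- ι k ℚ.* 1/[1+ u ]

coef-shift-∉ : ∀ u k k′ s → s ⊓ k ≡ s ⊓ k′ →
               coef k s (suc u) ≡ coef k′ s (suc (suc u)) ℚ.+ shift u k k′ ℚ.* ι s
coef-shift-∉ u k k′ s eq = begin
  coef k s (suc u)
    ≡⟨ coef-suc k s u ⟩
  ι (s ⊓ k) ℚ.- K ℚ.* S ℚ.* W
    ≡⟨ solve 6 (λ B K K′ S W W′ → B :- K :* S :* W := (B :- K′ :* S :* W′) :+ (K′ :* W′ :- K :* W) :* S)
         refl (ι (s ⊓ k)) K K′ S W W′ ⟩
  (ι (s ⊓ k) ℚ.- K′ ℚ.* S ℚ.* W′) ℚ.+ shift u k k′ ℚ.* S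
    ≡⟨ cong (λ z → (ι z ℚ.- K′ ℚ.* S ℚ.* W′) ℚ.+ shift u k k′ ℚ.* S) eq ⟩
  (ι (s ⊓ k′) ℚ.- K′ ℚ.* S ℚ.* W′) ℚ.+ shift u k k′ ℚ.* S
    ≡⟨ cong (ℚ._+ shift u k k′ ℚ.* S) (coef-suc k′ s (suc u)) ⟨
  coef k′ s (suc (suc u)) ℚ.+ shift u k k′ ℚ.* S ∎
  where
  open ≡-Reasoning
  open +-*-Solver
  K = ι k; K′ = ι k′; S = ι s; W = 1/[1+ u ]; W′ = 1/[1+ suc u ]

private
  shift-∈-identity : ∀ A B K K′ G N W W′ → N ℚ.* W ≡ 1ℚ → (1ℚ ℚ.+ N) ℚ.* W′ ≡ 1ℚ →
    B ℚ.+ K ≡ A ℚ.+ K′ →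
    A ℚ.- K ℚ.* G ℚ.* W
      ≡ (B ℚ.- K′ ℚ.* (1ℚ ℚ.+ G) ℚ.* W′) ℚ.+ (K′ ℚ.* W′ ℚ.- K ℚ.* W) ℚ.* ((1ℚ ℚ.+ G) ℚ.- (1ℚ ℚ.+ N))
  shift-∈-identity A B K K′ G N W W′ NW≡1 N′W′≡1 B+K≡A+K′ = sym (begin
    (B ℚ.- K′ ℚ.* (1ℚ ℚ.+ G) ℚ.* W′) ℚ.+ (K′ ℚ.* W′ ℚ.- K ℚ.* W) ℚ.* ((1ℚ ℚ.+ G) ℚ.- (1ℚ ℚ.+ N))
      ≡⟨ solve 8 (λ B K K′ G N W W′ A →
           (B :- K′ :* (con 1ℚ :+ G) :* W′) :+ (K′ :* W′ :- K :* W) :* ((con 1ℚ :+ G) :- (con 1ℚ :+ N))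
           := (B :+ K) :- K′ :* ((con 1ℚ :+ N) :* W′) :- K :* G :* W :- K :+ K :* (N :* W))
         refl B K K′ G N W W′ A ⟩
    (B ℚ.+ K) ℚ.- K′ ℚ.* ((1ℚ ℚ.+ N) ℚ.* W′) ℚ.- K ℚ.* G ℚ.* W ℚ.- K ℚ.+ K ℚ.* (N ℚ.* W)
      ≡⟨ cong₂ (λ x y → (B ℚ.+ K) ℚ.- K′ ℚ.* x ℚ.- K ℚ.* G ℚ.* W ℚ.- K ℚ.+ K ℚ.* y) N′W′≡1 NW≡1 ⟩
    (B ℚ.+ K) ℚ.- K′ ℚ.* 1ℚ ℚ.- K ℚ.* G ℚ.* W ℚ.- K ℚ.+ K ℚ.* 1ℚ
      ≡⟨ cong (λ x → x ℚ.- K′ ℚ.* 1ℚ ℚ.- K ℚ.* G ℚ.* W ℚ.- K ℚ.+ K ℚ.* 1ℚ) B+K≡A+K′ ⟩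
    (A ℚ.+ K′) ℚ.- K′ ℚ.* 1ℚ ℚ.- K ℚ.* G ℚ.* W ℚ.- K ℚ.+ K ℚ.* 1ℚ
      ≡⟨ solve 5 (λ A K K′ G W →
           (A :+ K′) :- K′ :* con 1ℚ :- K :* G :* W :- K :+ K :* con 1ℚ := A :- K :* G :* W)
         refl A K K′ G W ⟩
    A ℚ.- K ℚ.* G ℚ.* W ∎)
    where open ≡-Reasoning; open +-*-Solver

-- The hypothesis is min(g + 1, k′) - k′ = min(g, k) - k, rearranged to avoid truncated subtraction.
coef-shift-∈ : ∀ u k k′ g → suc g ⊓ k′ ℕ.+ k ≡ g ⊓ k ℕ.+ k′ →
               coef k g (suc u)
                 ≡ coef k′ (suc g) (suc (suc u)) ℚ.+ shift u k k′ ℚ.* (ι (suc g) ℚ.- ι (suc (suc u)))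
coef-shift-∈ u k k′ g eq = begin
  coef k g (suc u)
    ≡⟨ coef-suc k g u ⟩
  ι (g ⊓ k) ℚ.- K ℚ.* ι g ℚ.* W
    ≡⟨ shift-∈-identity (ι (g ⊓ k)) (ι (suc g ⊓ k′)) K K′ (ι g) (ι (suc u)) W W′ (ι-*-1/[1+] u)
         (trans (cong (ℚ._* W′) (sym (ι-suc (suc u)))) (ι-*-1/[1+] (suc u)))
         (trans (sym (ι-+ (suc g ⊓ k′) k)) (trans (cong ι eq) (ι-+ (g ⊓ k) k′))) ⟩
  (ι (suc g ⊓ k′) ℚ.- K′ ℚ.* (1ℚ ℚ.+ ι g) ℚ.* W′) ℚ.+ Δ ℚ.* ((1ℚ ℚ.+ ι g) ℚ.- (1ℚ ℚ.+ ι (suc u)))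
    ≡⟨ cong₂ (λ x y → (ι (suc g ⊓ k′) ℚ.- K′ ℚ.* x ℚ.* W′) ℚ.+ Δ ℚ.* (x ℚ.- y)) (ι-suc g) (ι-suc (suc u)) ⟨
  (ι (suc g ⊓ k′) ℚ.- K′ ℚ.* ι (suc g) ℚ.* W′) ℚ.+ Δ ℚ.* (ι (suc g) ℚ.- ι (suc (suc u)))
    ≡⟨ cong (ℚ._+ Δ ℚ.* (ι (suc g) ℚ.- ι (suc (suc u)))) (coef-suc k′ (suc g) (suc u)) ⟨
  coef k′ (suc g) (suc (suc u)) ℚ.+ Δ ℚ.* (ι (suc g) ℚ.- ι (suc (suc u))) ∎
  where
  open ≡-Reasoning
  Δ = shift u k k′
  K = ι k; K′ = ι k′; W = 1/[1+ u ]; W′ = 1/[1+ suc u ]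

infix 4 _⊆ᵇ_
_⊆ᵇ_ : ∀ {k} → Subset k → Subset k → Bool
[]            ⊆ᵇ []            = true
(outside ∷ S) ⊆ᵇ (_       ∷ U) = S ⊆ᵇ U
(inside  ∷ S) ⊆ᵇ (outside ∷ U) = false
(inside  ∷ S) ⊆ᵇ (inside  ∷ U) = S ⊆ᵇ U

module _ {k : ℕ} where

  lookup-∈ : ∀ {x : Fin k} {p} → x ∈ p → lookup p x ≡ true
  lookup-∈ = Vecₚ.[]=⇒lookup

  ∈-lookup : ∀ {x : Fin k} {p} → lookup p x ≡ true → x ∈ p
  ∈-lookup {x} {p} = Vecₚ.lookup⇒[]= x p

  ∉-lookup : ∀ {x : Fin k} {p} → lookup p x ≡ false → x ∉ p
  ∉-lookup eq x∈p with () ← trans (sym eq) (lookup-∈ x∈p)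

lookup-⊤ : ∀ {k} (x : Fin k) → lookup ⊤ x ≡ true
lookup-⊤ x = Vecₚ.lookup-replicate x true

lookup[p-x]x≡false : ∀ {k} (x : Fin k) (p : Subset k) → lookup (p - x) x ≡ false
lookup[p-x]x≡false zero    (_ ∷ p) = refl
lookup[p-x]x≡false (suc x) (_ ∷ p) = lookup[p-x]x≡false x p

x∈p-y⇒x≢y : ∀ {k} {x y : Fin k} {p} → x ∈ p - y → x ≢ y
x∈p-y⇒x≢y {y = y} {p} x∈p-y refl = ∉-lookup (lookup[p-x]x≡false y p) x∈p-y

∪⁅x⁆-x : ∀ {k} (x : Fin k) (p : Subset k) → lookup p x ≡ false → (p ∪ ⁅ x ⁆) - x ≡ p
∪⁅x⁆-x zero    (outside ∷ p) _  = cong (outside ∷_) (trans (Sub.p─⊥≡p (p ∪ ⊥)) (Sub.∪-identityʳ p))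
∪⁅x⁆-x (suc x) (outside ∷ p) eq = cong (outside ∷_) (∪⁅x⁆-x x p eq)
∪⁅x⁆-x (suc x) (inside  ∷ p) eq = cong (inside ∷_) (∪⁅x⁆-x x p eq)

∣p∣≡1+∣p-x∣ : ∀ {k} (x : Fin k) (p : Subset k) → lookup p x ≡ true → ∣ p ∣ ≡ suc ∣ p - x ∣
∣p∣≡1+∣p-x∣ zero    (inside  ∷ p) _  = cong (λ q → suc ∣ q ∣) (sym (Sub.p─⊥≡p p))
∣p∣≡1+∣p-x∣ (suc x) (outside ∷ p) eq = ∣p∣≡1+∣p-x∣ x p eq
∣p∣≡1+∣p-x∣ (suc x) (inside  ∷ p) eq = cong suc (∣p∣≡1+∣p-x∣ x p eq)

∣⊤-x∣≡n : ∀ {n} (x : Fin (suc n)) → ∣ ⊤ - x ∣ ≡ n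
∣⊤-x∣≡n {n} x = ℕₚ.suc-injective (trans (sym (∣p∣≡1+∣p-x∣ x ⊤ (lookup-⊤ x))) (Sub.∣⊤∣≡n (suc n)))

⊆ᵇ-⊤ : ∀ {k} (p : Subset k) → (p ⊆ᵇ ⊤) ≡ true
⊆ᵇ-⊤ []            = refl
⊆ᵇ-⊤ (outside ∷ p) = ⊆ᵇ-⊤ p
⊆ᵇ-⊤ (inside  ∷ p) = ⊆ᵇ-⊤ p

⊆ᵇ-⊤-x : ∀ {k} (x : Fin k) (p : Subset k) → (p ⊆ᵇ ⊤ - x) ≡ not (lookup p x)
⊆ᵇ-⊤-x zero    (outside ∷ p) = trans (cong (p ⊆ᵇ_) (Sub.p─⊥≡p ⊤)) (⊆ᵇ-⊤ p)
⊆ᵇ-⊤-x zero    (inside  ∷ p) = refl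
⊆ᵇ-⊤-x (suc x) (outside ∷ p) = ⊆ᵇ-⊤-x x p
⊆ᵇ-⊤-x (suc x) (inside  ∷ p) = ⊆ᵇ-⊤-x x p

Nonempty⇒1≤∣p∣ : ∀ {k} {p : Subset k} → Nonempty p → 1 ℕ.≤ ∣ p ∣
Nonempty⇒1≤∣p∣ {p = p} (x , x∈p) = subst (ℕ._≤ ∣ p ∣) (Sub.∣⁅x⁆∣≡1 x)
  (Sub.p⊆q⇒∣p∣≤∣q∣ (λ y∈⁅x⁆ → subst (_∈ p) (sym (Sub.x∈⁅y⁆⇒x≡y x y∈⁅x⁆)) x∈p))

1≤∣p∣⇒Nonempty : ∀ {k} {p : Subset k} → 1 ℕ.≤ ∣ p ∣ → Nonempty p
1≤∣p∣⇒Nonempty {k} {p} 1≤∣p∣ with Sub.nonempty? p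
... | yes ne = ne
... | no ¬ne = ⊥-elim (ℕₚ.<⇒≢ 1≤∣p∣ (sym (trans (cong ∣_∣ (Sub.Empty-unique ¬ne)) (Sub.∣⊥∣≡0 k))))

x∉p⇒∣p∣≤n : ∀ {n} {x : Fin (suc n)} {p : Subset (suc n)} → x ∉ p → ∣ p ∣ ℕ.≤ n
x∉p⇒∣p∣≤n {n} {x} {p} x∉p = ℕₚ.≤-pred
  (subst (∣ p ∣ ℕ.<_) (Sub.∣⊤∣≡n (suc n)) (Sub.p⊂q⇒∣p∣<∣q∣ (Sub.⊆⊤ , x , Sub.∈⊤ , x∉p)))

does-∈? : ∀ {k} (x : Fin k) (p : Subset k) → does (x Sub.∈? p) ≡ lookup p x
does-∈? zero    (inside  ∷ p) = refl
does-∈? zero    (outside ∷ p) = refl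
does-∈? (suc x) (_       ∷ p) = does-∈? x p

rank-raise-⊆ : ∀ {m} (M : Matroid m) {G T : Subset m} x → G ⊆ T →
               rank M T ℕ.< rank M (T ∪ ⁅ x ⁆) → rank M G ℕ.< rank M (G ∪ ⁅ x ⁆)
rank-raise-⊆ M {G} {T} x G⊆T T<T∪x = ℕₚ.+-cancelˡ-< (rank M (T ∪ ⁅ x ⁆)) _ _ (begin-strict
  rank M (T ∪ ⁅ x ⁆) ℕ.+ rank M G                    ≤⟨ ℕₚ.+-mono-≤ (rank-mono M T∪x⊆) (rank-mono M G⊆) ⟩
  rank M ((G ∪ ⁅ x ⁆) ∪ T) ℕ.+ rank M ((G ∪ ⁅ x ⁆) ∩ T) ≤⟨ rank-submod M (G ∪ ⁅ x ⁆) T ⟩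
  rank M (G ∪ ⁅ x ⁆) ℕ.+ rank M T                     <⟨ ℕₚ.+-monoʳ-< (rank M (G ∪ ⁅ x ⁆)) T<T∪x ⟩
  rank M (G ∪ ⁅ x ⁆) ℕ.+ rank M (T ∪ ⁅ x ⁆)           ≡⟨ ℕₚ.+-comm (rank M (G ∪ ⁅ x ⁆)) (rank M (T ∪ ⁅ x ⁆)) ⟩
  rank M (T ∪ ⁅ x ⁆) ℕ.+ rank M (G ∪ ⁅ x ⁆)           ∎)
  where
  open ℕₚ.≤-Reasoning
  T∪x⊆ : T ∪ ⁅ x ⁆ ⊆ (G ∪ ⁅ x ⁆) ∪ T
  T∪x⊆ y∈ with Sub.x∈p∪q⁻ T ⁅ x ⁆ y∈
  ... | inj₁ y∈T = Sub.x∈p∪q⁺ (inj₂ y∈T)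
  ... | inj₂ y∈x = Sub.x∈p∪q⁺ (inj₁ (Sub.x∈p∪q⁺ (inj₂ y∈x)))
  G⊆ : G ⊆ (G ∪ ⁅ x ⁆) ∩ T
  G⊆ y∈G = Sub.x∈p∩q⁺ (Sub.x∈p∪q⁺ (inj₁ y∈G) , G⊆T y∈G)

∑ : ∀ {m k} → (Subset k → Expr m) → Expr m
∑ {k = zero}  f = f []
∑ {k = suc k} f = ∑ (λ S → f (outside ∷ S)) ⊕ ∑ (λ S → f (inside ∷ S))

∑ᶠ : ∀ {m k} → (Fin k → Expr m) → Expr m
∑ᶠ {k = zero}  f = con 0ℚ
∑ᶠ {k = suc k} f = f zero ⊕ ∑ᶠ (λ a → f (suc a))

when : ∀ {m} → Bool → Expr m → Expr m
when b x = if b then x else con 0ℚ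

𝟙 : Bool → ℚ
𝟙 b = if b then 1ℚ else 0ℚ

ΣE-map : ∀ {m} {A B : Set} (g : A → B) (xs : List A) (f : B → Expr m) →
         ΣE (map g xs) f ≡ ΣE xs (λ x → f (g x))
ΣE-map g []       f = refl
ΣE-map g (x ∷ xs) f = cong (f (g x) ⊕_) (ΣE-map g xs f)

module PresentedAlgebra {m : ℕ} (R : Expr m → Set) where

  infix 4 _≈_
  _≈_ : Expr m → Expr m → Set₁
  x ≈ y = Defs._≈⟨_⟩_ x R y

  ≈-setoid : Setoid 0ℓ (lsuc 0ℓ)
  ≈-setoid = record
    { Carrier = Expr m ; _≈_ = _≈_
    ; isEquivalence = record { refl = ≈-refl ; sym = ≈-sym ; trans = ≈-trans } }

  module ≈-Reasoning = Relation.Binary.Reasoning.Setoid ≈-setoid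
  open ≈-Reasoning
  open Algebra.Consequences.Setoid ≈-setoid
    using (comm∧idˡ⇒id; comm∧invˡ⇒inv; comm∧distrˡ⇒distr)

  isCommutativeRing : IsCommutativeRing _≈_ _⊕_ _⊗_ ⊖_ (con 0ℚ) (con 1ℚ)
  isCommutativeRing = record
    { isRing = record
      { +-isAbelianGroup = record
        { isGroup = record
          { isMonoid = record
            { isSemigroup = record
              { isMagma = record
                { isEquivalence = Setoid.isEquivalence ≈-setoid ; ∙-cong = ⊕-cong }
              ; assoc = λ _ _ _ → ⊕-assoc }
            ; identity = comm∧idˡ⇒id (λ x y → ⊕-comm {x = x} {y}) (λ x → ⊕-idˡ {x = x}) }
          ; inverse = comm∧invˡ⇒inv (λ x y → ⊕-comm {x = x} {y}) (λ x → ⊖-invˡ {x = x})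
          ; ⁻¹-cong = ⊖-cong }
        ; comm = λ _ _ → ⊕-comm }
      ; *-cong = ⊗-cong
      ; *-assoc = λ _ _ _ → ⊗-assoc
      ; *-identity = comm∧idˡ⇒id (λ x y → ⊗-comm {x = x} {y}) (λ x → ⊗-idˡ {x = x})
      ; distrib = comm∧distrˡ⇒distr ⊕-cong (λ x y → ⊗-comm {x = x} {y}) (λ x y z → distribˡ {x = x} {y} {z}) }
    ; *-comm = λ _ _ → ⊗-comm }

  commutativeRing : CommutativeRing 0ℓ (lsuc 0ℓ)
  commutativeRing = record { isCommutativeRing = isCommutativeRing }

  open CommutativeRing commutativeRing public
    using (+-identityʳ; zeroˡ; zeroʳ; distribʳ; +-group)

  ≈-reflexive : ∀ {x y} → x ≡ y → x ≈ y
  ≈-reflexive refl = ≈-refl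

  con-+-⊗ : ∀ p q x → con (p ℚ.+ q) ⊗ x ≈ con p ⊗ x ⊕ con q ⊗ x
  con-+-⊗ p q x = ≈-trans (⊗-cong (≈-sym con-+) ≈-refl) (distribʳ x (con p) (con q))

  con-*-⊗ : ∀ p q x → con (p ℚ.* q) ⊗ x ≈ con p ⊗ (con q ⊗ x)
  con-*-⊗ p q x = ≈-trans (⊗-cong (≈-sym con-*) ≈-refl) ⊗-assoc

  con-cong-⊗ : ∀ {p q} x → p ≡ q → con p ⊗ x ≈ con q ⊗ x
  con-cong-⊗ x refl = ≈-refl

  when-≈-𝟙 : ∀ b x → when b x ≈ con (𝟙 b) ⊗ x
  when-≈-𝟙 true  x = ≈-sym ⊗-idˡ
  when-≈-𝟙 false x = ≈-sym (zeroˡ x)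

  ∑-cong : ∀ {k} {f g : Subset k → Expr m} → (∀ S → f S ≈ g S) → ∑ f ≈ ∑ g
  ∑-cong {zero}  f≈g = f≈g []
  ∑-cong {suc k} f≈g = ⊕-cong (∑-cong {k} (λ S → f≈g _)) (∑-cong {k} (λ S → f≈g _))

  ∑-zero : ∀ {k} → ∑ {k = k} (λ _ → con 0ℚ) ≈ con 0ℚ
  ∑-zero {zero}  = ≈-refl
  ∑-zero {suc k} = ≈-trans (⊕-cong (∑-zero {k}) (∑-zero {k})) ⊕-idˡ

  ∑-⊕ : ∀ {k} (f g : Subset k → Expr m) → ∑ (λ S → f S ⊕ g S) ≈ ∑ f ⊕ ∑ g
  ∑-⊕ {zero}  f g = ≈-refl
  ∑-⊕ {suc k} f g = ≈-trans (⊕-cong (∑-⊕ {k} _ _) (∑-⊕ {k} _ _)) (interchange _ _ _ _)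
    where open Algebra.Properties.CommutativeSemigroup
            (CommutativeRing.+-commutativeSemigroup commutativeRing) using (interchange)

  ∑-distribʳ : ∀ {k} (f : Subset k → Expr m) x → ∑ f ⊗ x ≈ ∑ (λ S → f S ⊗ x)
  ∑-distribʳ {zero}  f x = ≈-refl
  ∑-distribʳ {suc k} f x =
    ≈-trans (distribʳ x _ _) (⊕-cong (∑-distribʳ {k} _ x) (∑-distribʳ {k} _ x))

  ∑-distribˡ : ∀ {k} x (f : Subset k → Expr m) → x ⊗ ∑ f ≈ ∑ (λ S → x ⊗ f S)
  ∑-distribˡ {k} x f = ≈-trans ⊗-comm (≈-trans (∑-distribʳ f x) (∑-cong {k} (λ _ → ⊗-comm)))

  ∑ᶠ-cong : ∀ {k} {f g : Fin k → Expr m} → (∀ a → f a ≈ g a) → ∑ᶠ f ≈ ∑ᶠ g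
  ∑ᶠ-cong {zero}  f≈g = ≈-refl
  ∑ᶠ-cong {suc k} f≈g = ⊕-cong (f≈g zero) (∑ᶠ-cong (λ a → f≈g (suc a)))

  ∑-∑ᶠ-comm : ∀ {k l} (f : Fin l → Subset k → Expr m) →
              ∑ (λ S → ∑ᶠ (λ a → f a S)) ≈ ∑ᶠ (λ a → ∑ (f a))
  ∑-∑ᶠ-comm {k} {zero}  f = ∑-zero {k}
  ∑-∑ᶠ-comm {k} {suc l} f =
    ≈-trans (∑-⊕ {k} (f zero) _) (⊕-cong ≈-refl (∑-∑ᶠ-comm (λ a → f (suc a))))

  ΣE-++ : ∀ {A : Set} (xs ys : List A) (f : A → Expr m) → ΣE (xs ++ ys) f ≈ ΣE xs f ⊕ ΣE ys f
  ΣE-++ []       ys f = ≈-sym ⊕-idˡ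
  ΣE-++ (x ∷ xs) ys f = ≈-trans (⊕-cong ≈-refl (ΣE-++ xs ys f)) (≈-sym ⊕-assoc)

  ΣE-filter : ∀ {A : Set} {p} {P : Pred A p} (P? : Decidable P) (xs : List A) (f : A → Expr m) →
              ΣE (filter P? xs) f ≈ ΣE xs (λ x → when (does (P? x)) (f x))
  ΣE-filter P? []       f = ≈-refl
  ΣE-filter P? (x ∷ xs) f with does (P? x)
  ... | true  = ⊕-cong ≈-refl (ΣE-filter P? xs f)
  ... | false = ≈-trans (ΣE-filter P? xs f) (≈-sym ⊕-idˡ)

  ΣE-subsetsOf : ∀ {k} (U : Subset k) (f : Subset k → Expr m) →
                 ΣE (subsetsOf U) f ≈ ∑ (λ S → when (S ⊆ᵇ U) (f S))
  ΣE-subsetsOf []            f = +-identityʳ _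
  ΣE-subsetsOf {suc k} (outside ∷ U) f = begin
    ΣE (map (outside ∷_) (subsetsOf U)) f         ≡⟨ ΣE-map _ (subsetsOf U) f ⟩
    ΣE (subsetsOf U) (λ S → f (outside ∷ S))      ≈⟨ ΣE-subsetsOf U _ ⟩
    ∑ (λ S → when (S ⊆ᵇ U) (f (outside ∷ S)))     ≈⟨ +-identityʳ _ ⟨
    ∑ (λ S → when (S ⊆ᵇ U) (f (outside ∷ S))) ⊕ con 0ℚ ≈⟨ ⊕-cong ≈-refl (∑-zero {k}) ⟨
    ∑ (λ S → when ((outside ∷ S) ⊆ᵇ (outside ∷ U)) (f (outside ∷ S)))
      ⊕ ∑ (λ S → when ((inside ∷ S) ⊆ᵇ (outside ∷ U)) (f (inside ∷ S)))  ∎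
  ΣE-subsetsOf (inside ∷ U) f = begin
    ΣE (map (outside ∷_) (subsetsOf U) ++ map (inside ∷_) (subsetsOf U)) f
      ≈⟨ ΣE-++ (map (outside ∷_) (subsetsOf U)) _ f ⟩
    ΣE (map (outside ∷_) (subsetsOf U)) f ⊕ ΣE (map (inside ∷_) (subsetsOf U)) f
      ≡⟨ cong₂ _⊕_ (ΣE-map _ (subsetsOf U) f) (ΣE-map _ (subsetsOf U) f) ⟩
    ΣE (subsetsOf U) (λ S → f (outside ∷ S)) ⊕ ΣE (subsetsOf U) (λ S → f (inside ∷ S))
      ≈⟨ ⊕-cong (ΣE-subsetsOf U _) (ΣE-subsetsOf U _) ⟩
    ∑ (λ S → when (S ⊆ᵇ U) (f (outside ∷ S))) ⊕ ∑ (λ S → when (S ⊆ᵇ U) (f (inside ∷ S))) ∎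

  ∑-∪⁅x⁆ : ∀ {k} (x : Fin k) (f : Subset k → Expr m) →
           ∑ (λ S → when (not (lookup S x)) (f (S ∪ ⁅ x ⁆))) ≈ ∑ (λ T → when (lookup T x) (f T))
  ∑-∪⁅x⁆ {suc k} zero f = begin
    ∑ (λ S → f (inside ∷ (S ∪ ⊥))) ⊕ ∑ {k = k} (λ _ → con 0ℚ)
      ≈⟨ ⊕-cong (∑-cong {k} (λ S → ≈-reflexive (cong (λ q → f (inside ∷ q)) (Sub.∪-identityʳ S))))
                (∑-zero {k}) ⟩
    ∑ (λ S → f (inside ∷ S)) ⊕ con 0ℚ        ≈⟨ ⊕-comm ⟩
    con 0ℚ ⊕ ∑ (λ S → f (inside ∷ S))        ≈⟨ ⊕-cong (∑-zero {k}) ≈-refl ⟨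
    ∑ {k = k} (λ _ → con 0ℚ) ⊕ ∑ (λ S → f (inside ∷ S)) ∎
  ∑-∪⁅x⁆ {suc k} (suc x) f =
    ⊕-cong (∑-∪⁅x⁆ x (λ S → f (outside ∷ S))) (∑-∪⁅x⁆ x (λ S → f (inside ∷ S)))

  ∑ᶠ-const : ∀ k x → ∑ᶠ {k = k} (λ _ → x) ≈ con (ι k) ⊗ x
  ∑ᶠ-const zero    x = ≈-sym (zeroˡ x)
  ∑ᶠ-const (suc k) x = begin
    x ⊕ ∑ᶠ (λ _ → x)                ≈⟨ ⊕-cong (≈-sym ⊗-idˡ) (∑ᶠ-const k x) ⟩
    con 1ℚ ⊗ x ⊕ con (ι k) ⊗ x      ≈⟨ con-+-⊗ 1ℚ (ι k) x ⟨
    con (1ℚ ℚ.+ ι k) ⊗ x            ≈⟨ con-cong-⊗ x (ι-suc k) ⟨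
    con (ι (suc k)) ⊗ x             ∎

  con-∣p∣-⊗ : ∀ {k} (p : Subset k) x → con (ι ∣ p ∣) ⊗ x ≈ ∑ᶠ (λ a → con (𝟙 (lookup p a)) ⊗ x)
  con-∣p∣-⊗ []            x = zeroˡ x
  con-∣p∣-⊗ (outside ∷ p) x =
    ≈-trans (con-∣p∣-⊗ p x) (≈-trans (≈-sym ⊕-idˡ) (⊕-cong (≈-sym (zeroˡ x)) ≈-refl))
  con-∣p∣-⊗ (inside  ∷ p) x = begin
    con (ι (suc ∣ p ∣)) ⊗ x          ≈⟨ con-cong-⊗ x (ι-suc ∣ p ∣) ⟩
    con (1ℚ ℚ.+ ι ∣ p ∣) ⊗ x         ≈⟨ con-+-⊗ 1ℚ (ι ∣ p ∣) x ⟩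
    con 1ℚ ⊗ x ⊕ con (ι ∣ p ∣) ⊗ x   ≈⟨ ⊕-cong ≈-refl (con-∣p∣-⊗ p x) ⟩
    con 1ℚ ⊗ x ⊕ ∑ᶠ (λ a → con (𝟙 (lookup p a)) ⊗ x) ∎

  ∑-⊗-var⊕var∪⁅x⁆ : ∀ (x : Fin m) (a : Subset m → ℚ) → (∀ S → lookup S x ≡ true → a S ≡ 0ℚ) →
                    ∑ (λ S → con (a S) ⊗ (var S ⊕ var (S ∪ ⁅ x ⁆)))
                      ≈ ∑ (λ T → con (if lookup T x then a (T - x) else a T) ⊗ var T)
  ∑-⊗-var⊕var∪⁅x⁆ x a a-vanishes = begin
    ∑ (λ S → con (a S) ⊗ (var S ⊕ var (S ∪ ⁅ x ⁆)))
      ≈⟨ ∑-cong (λ S → distribˡ {x = con (a S)} {var S} {var (S ∪ ⁅ x ⁆)}) ⟩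
    ∑ (λ S → con (a S) ⊗ var S ⊕ con (a S) ⊗ var (S ∪ ⁅ x ⁆))
      ≈⟨ ∑-⊕ (λ S → con (a S) ⊗ var S) (λ S → con (a S) ⊗ var (S ∪ ⁅ x ⁆)) ⟩
    ∑ (λ S → con (a S) ⊗ var S) ⊕ ∑ (λ S → con (a S) ⊗ var (S ∪ ⁅ x ⁆))
      ≈⟨ ⊕-cong ≈-refl (≈-trans (∑-cong added) (∑-∪⁅x⁆ x (λ T → con (a (T - x)) ⊗ var T))) ⟩
    ∑ (λ T → con (a T) ⊗ var T) ⊕ ∑ (λ T → when (lookup T x) (con (a (T - x)) ⊗ var T))
      ≈⟨ ∑-⊕ (λ T → con (a T) ⊗ var T) (λ T → when (lookup T x) (con (a (T - x)) ⊗ var T)) ⟨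
    ∑ (λ T → con (a T) ⊗ var T ⊕ when (lookup T x) (con (a (T - x)) ⊗ var T))
      ≈⟨ ∑-cong merged ⟩
    ∑ (λ T → con (if lookup T x then a (T - x) else a T) ⊗ var T) ∎
    where
    added : ∀ S → con (a S) ⊗ var (S ∪ ⁅ x ⁆)
                    ≈ when (not (lookup S x)) (con (a ((S ∪ ⁅ x ⁆) - x)) ⊗ var (S ∪ ⁅ x ⁆))
    added S with lookup S x in eq
    ... | true  = ≈-trans (con-cong-⊗ _ (a-vanishes S eq)) (zeroˡ _)
    ... | false = con-cong-⊗ _ (cong a (sym (∪⁅x⁆-x x S eq)))

    merged : ∀ T → con (a T) ⊗ var T ⊕ when (lookup T x) (con (a (T - x)) ⊗ var T)
                     ≈ con (if lookup T x then a (T - x) else a T) ⊗ var T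
    merged T with lookup T x in eq
    ... | true  = ≈-trans (⊕-cong (≈-trans (con-cong-⊗ _ (a-vanishes T eq)) (zeroˡ _)) ≈-refl) ⊕-idˡ
    ... | false = +-identityʳ _

-- Hypersimplex classes in normal form

nonemptyProper? : ∀ {m} (U S : Subset m) → Dec (1 ℕ.≤ ∣ S ∣ × suc ∣ S ∣ ℕ.≤ ∣ U ∣)
nonemptyProper? U S = (1 ≤? ∣ S ∣) ×-dec (suc ∣ S ∣ ≤? ∣ U ∣)

γ-coef : ∀ {m} → Subset m → ℕ → Subset m → ℚ
γ-coef U k S = if (S ⊆ᵇ U) ∧ does (nonemptyProper? U S) then coef k ∣ S ∣ ∣ U ∣ else 0ℚ

γ-coef≡0 : ∀ {m} (U : Subset m) k S → (1 ℕ.≤ ∣ S ∣ → suc ∣ S ∣ ℕ.≤ ∣ U ∣ → coef k ∣ S ∣ ∣ U ∣ ≡ 0ℚ) →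
           γ-coef U k S ≡ 0ℚ
γ-coef≡0 U k S vanish = go (S ⊆ᵇ U) (nonemptyProper? U S)
  where
  go : ∀ b (d : Dec (1 ℕ.≤ ∣ S ∣ × suc ∣ S ∣ ℕ.≤ ∣ U ∣)) →
       (if b ∧ does d then coef k ∣ S ∣ ∣ U ∣ else 0ℚ) ≡ 0ℚ
  go false _                  = refl
  go true  (no  _)            = refl
  go true  (yes (1≤s , s<u))  = vanish 1≤s s<u

-- γ U (+ k) unfolds to hypersimplexSum U k (λ q S → con q ⊗ var S).
hypersimplexSum : ∀ {m} → Subset m → ℕ → (ℚ → Subset m → Expr m) → Expr m
hypersimplexSum U k B =
  when (does (1 ≤? k) ∧ does (suc k ≤? ∣ U ∣))
       (ΣE (filter (nonemptyProper? U) (subsetsOf U)) (λ S → B (coef k ∣ S ∣ ∣ U ∣) S))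

θ-ΣE : ∀ {m} {A : Set} V r i (xs : List A) (f : A → Expr m) →
       θ V r i (ΣE xs f) ≡ ΣE xs (λ x → θ V r i (f x))
θ-ΣE V r i []       f = refl
θ-ΣE V r i (x ∷ xs) f = cong (θ V r i (f x) ⊕_) (θ-ΣE V r i xs f)

θ-hypersimplexSum : ∀ {m} (U V : Subset m) r i k B →
                    θ V r i (hypersimplexSum U k B) ≡ hypersimplexSum U k (λ q S → θ V r i (B q S))
θ-hypersimplexSum U V r i k B =
  trans (θ-when (does (1 ≤? k) ∧ does (suc k ≤? ∣ U ∣)) _)
        (cong (when _) (θ-ΣE V r i (filter (nonemptyProper? U) (subsetsOf U)) (λ S → B (coef k ∣ S ∣ ∣ U ∣) S)))
  where
  θ-when : ∀ b x → θ V r i (when b x) ≡ when b (θ V r i x)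
  θ-when true  x = refl
  θ-when false x = refl

γ-out-of-range : ∀ {m} (U : Subset m) k → ¬ (suc k ℕ.≤ ∣ U ∣) → γ U (+ k) ≡ con 0ℚ
γ-out-of-range U k k≮∣U∣ = go (1 ≤? k) (suc k ≤? ∣ U ∣)
  where
  go : (d : Dec (1 ℕ.≤ k)) (e : Dec (suc k ℕ.≤ ∣ U ∣)) →
       when (does d ∧ does e) (ΣE (filter (nonemptyProper? U) (subsetsOf U))
                                  (λ S → con (coef k ∣ S ∣ ∣ U ∣) ⊗ var S)) ≡ con 0ℚ
  go (yes _) (yes k<∣U∣) = ⊥-elim (k≮∣U∣ k<∣U∣)
  go (yes _) (no  _)     = refl
  go (no  _) _           = refl

module _ {m : ℕ} (R : Expr m → Set) where
  open PresentedAlgebra R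
  open ≈-Reasoning

  ∑-γ-coef-vanishing : ∀ (U : Subset m) k (B : ℚ → Subset m → Expr m) → (∀ S → B 0ℚ S ≈ con 0ℚ) →
                       (∀ S → 1 ℕ.≤ ∣ S ∣ → suc ∣ S ∣ ℕ.≤ ∣ U ∣ → coef k ∣ S ∣ ∣ U ∣ ≡ 0ℚ) →
                       ∑ (λ S → B (γ-coef U k S) S) ≈ con 0ℚ
  ∑-γ-coef-vanishing U k B B0≈0 vanish = ≈-trans
    (∑-cong (λ S → ≈-trans (≈-reflexive (cong (λ q → B q S) (γ-coef≡0 U k S (vanish S)))) (B0≈0 S)))
    (∑-zero {m})

  hypersimplexSum-≈ : ∀ (U : Subset m) k (B : ℚ → Subset m → Expr m) → (∀ S → B 0ℚ S ≈ con 0ℚ) →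
                      k ℕ.≤ ∣ U ∣ → hypersimplexSum U k B ≈ ∑ (λ S → B (γ-coef U k S) S)
  hypersimplexSum-≈ U k B B0≈0 k≤∣U∣ = go (1 ≤? k) (suc k ≤? ∣ U ∣)
    where
    when-when : ∀ b c S → when b (when c (B (coef k ∣ S ∣ ∣ U ∣) S))
                            ≈ B (if b ∧ c then coef k ∣ S ∣ ∣ U ∣ else 0ℚ) S
    when-when true  true  S = ≈-refl
    when-when true  false S = ≈-sym (B0≈0 S)
    when-when false _     S = ≈-sym (B0≈0 S)

    go : (d : Dec (1 ℕ.≤ k)) (e : Dec (suc k ℕ.≤ ∣ U ∣)) →
         when (does d ∧ does e) (ΣE (filter (nonemptyProper? U) (subsetsOf U)) (λ S → B (coef k ∣ S ∣ ∣ U ∣) S))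
           ≈ ∑ (λ S → B (γ-coef U k S) S)
    go (yes _) (yes _) = begin
      ΣE (filter (nonemptyProper? U) (subsetsOf U)) (λ S → B (coef k ∣ S ∣ ∣ U ∣) S)
        ≈⟨ ΣE-filter (nonemptyProper? U) (subsetsOf U) _ ⟩
      ΣE (subsetsOf U) (λ S → when (does (nonemptyProper? U S)) (B (coef k ∣ S ∣ ∣ U ∣) S))
        ≈⟨ ΣE-subsetsOf U _ ⟩
      ∑ (λ S → when (S ⊆ᵇ U) (when (does (nonemptyProper? U S)) (B (coef k ∣ S ∣ ∣ U ∣) S)))
        ≈⟨ ∑-cong (λ S → when-when (S ⊆ᵇ U) (does (nonemptyProper? U S)) S) ⟩
      ∑ (λ S → B (γ-coef U k S) S) ∎
    go (no 1≰k) _ = ≈-sym (∑-γ-coef-vanishing U k B B0≈0 λ S _ _ →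
      subst (λ k → coef k ∣ S ∣ ∣ U ∣ ≡ 0ℚ) (sym (ℕₚ.n<1⇒n≡0 (ℕₚ.≰⇒> 1≰k))) (coef-zeroˡ ∣ S ∣ ∣ U ∣))
    go (yes _) (no k≮∣U∣) = ≈-sym (∑-γ-coef-vanishing U k B B0≈0 λ S _ s<u →
      subst (λ k → coef k ∣ S ∣ ∣ U ∣ ≡ 0ℚ) (sym (ℕₚ.≤-antisym k≤∣U∣ (ℕₚ.≮⇒≥ k≮∣U∣)))
            (coef-top ∣ S ∣ ∣ U ∣ (ℕₚ.<⇒≤ s<u)))

-- The Chow ring of M

module ChowRing {n : ℕ} (M : Matroid (suc n)) where

  private
    r = rank M

  open PresentedAlgebra (ChowRel ⊤ r)
  open ≈-Reasoning
  open Algebra.Properties.Group +-group using (x∙y⁻¹≈ε⇒x≈y)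

  γ-normalForm : ∀ ℓ → ℓ ℕ.≤ suc n → γ ⊤ (+ ℓ) ≈ ∑ (λ T → con (γ-coef ⊤ ℓ T) ⊗ var T)
  γ-normalForm ℓ ℓ≤1+n = hypersimplexSum-≈ (ChowRel ⊤ r) ⊤ ℓ (λ q S → con q ⊗ var S) (λ S → zeroˡ (var S))
    (subst (ℓ ℕ.≤_) (sym (Sub.∣⊤∣≡n (suc n))) ℓ≤1+n)

  γ-coef-flat : ∀ ℓ T → IsNPFlat ⊤ r T → γ-coef ⊤ ℓ T ≡ coef ℓ ∣ T ∣ (suc n)
  γ-coef-flat ℓ T (nonempty , (e , _ , e∉T) , _) rewrite ⊆ᵇ-⊤ T = go (nonemptyProper? ⊤ T)
    where
    go : (d : Dec (1 ℕ.≤ ∣ T ∣ × suc ∣ T ∣ ℕ.≤ ∣ ⊤ {suc n} ∣)) →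
         (if does d then coef ℓ ∣ T ∣ ∣ ⊤ {suc n} ∣ else 0ℚ) ≡ coef ℓ ∣ T ∣ (suc n)
    go (yes _)     = cong (coef ℓ ∣ T ∣) (Sub.∣⊤∣≡n (suc n))
    go (no ¬sizes) = ⊥-elim (¬sizes (Nonempty⇒1≤∣p∣ nonempty ,
      subst (suc ∣ T ∣ ℕ.≤_) (sym (Sub.∣⊤∣≡n (suc n))) (s≤s (x∉p⇒∣p∣≤n e∉T))))

  flatsContaining : Fin (suc n) → Expr (suc n)
  flatsContaining a = ∑ (λ G → con (𝟙 (lookup G a)) ⊗ var G)

  ΣFlatsContaining≈flatsContaining : ∀ a → ΣFlatsContaining ⊤ r a ≈ flatsContaining a
  ΣFlatsContaining≈flatsContaining a = begin
    ΣFlatsContaining ⊤ r a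
      ≈⟨ ΣE-filter (λ G → isNPFlat? ⊤ r G ×-dec (a Sub.∈? G)) (subsetsOf ⊤) var ⟩
    ΣE (subsetsOf ⊤) (λ G → when (does (isNPFlat? ⊤ r G ×-dec (a Sub.∈? G))) (var G))
      ≈⟨ ΣE-subsetsOf ⊤ (λ G → when (does (isNPFlat? ⊤ r G ×-dec (a Sub.∈? G))) (var G)) ⟩
    ∑ (λ G → when (G ⊆ᵇ ⊤) (when (does (isNPFlat? ⊤ r G ×-dec (a Sub.∈? G))) (var G)))
      ≈⟨ ∑-cong pointwise ⟩
    flatsContaining a ∎
    where
    pointwise : ∀ G → when (G ⊆ᵇ ⊤) (when (does (isNPFlat? ⊤ r G ×-dec (a Sub.∈? G))) (var G))
                        ≈ con (𝟙 (lookup G a)) ⊗ var G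
    pointwise G rewrite ⊆ᵇ-⊤ G | sym (does-∈? a G) = go (isNPFlat? ⊤ r G) (does (a Sub.∈? G))
      where
      go : (d : Dec (IsNPFlat ⊤ r G)) (b : Bool) → when (does d ∧ b) (var G) ≈ con (𝟙 b) ⊗ var G
      go (yes _)    b = when-≈-𝟙 b (var G)
      go (no ¬flat) b = ≈-sym (≈-trans (⊗-cong ≈-refl (rel (nonflat ¬flat))) (zeroʳ _))

  flatsContaining-indep : ∀ a b → flatsContaining a ≈ flatsContaining b
  flatsContaining-indep a b = begin
    flatsContaining a       ≈⟨ ΣFlatsContaining≈flatsContaining a ⟨
    ΣFlatsContaining ⊤ r a  ≈⟨ x∙y⁻¹≈ε⇒x≈y _ _ (rel (linear Sub.∈⊤ Sub.∈⊤)) ⟩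
    ΣFlatsContaining ⊤ r b  ≈⟨ ΣFlatsContaining≈flatsContaining b ⟩
    flatsContaining b       ∎

  ∑-∣G∣-⊗-var : ∀ i → ∑ (λ G → con (ι ∣ G ∣) ⊗ var G) ≈ con (ι (suc n)) ⊗ flatsContaining i
  ∑-∣G∣-⊗-var i = begin
    ∑ (λ G → con (ι ∣ G ∣) ⊗ var G)                        ≈⟨ ∑-cong (λ G → con-∣p∣-⊗ G (var G)) ⟩
    ∑ (λ G → ∑ᶠ (λ a → con (𝟙 (lookup G a)) ⊗ var G))      ≈⟨ ∑-∑ᶠ-comm (λ a G → con (𝟙 (lookup G a)) ⊗ var G) ⟩
    ∑ᶠ flatsContaining                                     ≈⟨ ∑ᶠ-cong (λ a → flatsContaining-indep a i) ⟩
    ∑ᶠ (λ _ → flatsContaining i)                           ≈⟨ ∑ᶠ-const (suc n) (flatsContaining i) ⟩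
    con (ι (suc n)) ⊗ flatsContaining i                    ∎

  linearCoef : Fin (suc n) → Subset (suc n) → ℚ
  linearCoef i T = ι ∣ T ∣ ℚ.- ι (suc n) ℚ.* 𝟙 (lookup T i)

  linear-relation : ∀ i → ∑ (λ T → con (linearCoef i T) ⊗ var T) ≈ con 0ℚ
  linear-relation i = begin
    ∑ (λ T → con (linearCoef i T) ⊗ var T)
      ≈⟨ ∑-cong split ⟩
    ∑ (λ T → con (ι ∣ T ∣) ⊗ var T ⊕ scaled T)
      ≈⟨ ∑-⊕ (λ T → con (ι ∣ T ∣) ⊗ var T) scaled ⟩
    ∑ (λ T → con (ι ∣ T ∣) ⊗ var T) ⊕ ∑ scaled
      ≈⟨ ⊕-cong (∑-∣G∣-⊗-var i) (≈-sym (∑-distribˡ (con (ℚ.- N)) (λ T → con (𝟙 (lookup T i)) ⊗ var T))) ⟩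
    con N ⊗ flatsContaining i ⊕ con (ℚ.- N) ⊗ flatsContaining i
      ≈⟨ con-+-⊗ N (ℚ.- N) _ ⟨
    con (N ℚ.- N) ⊗ flatsContaining i
      ≈⟨ con-cong-⊗ _ (ℚₚ.+-inverseʳ N) ⟩
    con 0ℚ ⊗ flatsContaining i
      ≈⟨ zeroˡ _ ⟩
    con 0ℚ ∎
    where
    N = ι (suc n)
    scaled : Subset (suc n) → Expr (suc n)
    scaled T = con (ℚ.- N) ⊗ (con (𝟙 (lookup T i)) ⊗ var T)
    split : ∀ T → con (linearCoef i T) ⊗ var T ≈ con (ι ∣ T ∣) ⊗ var T ⊕ scaled T
    split T = ≈-trans (con-+-⊗ _ _ (var T)) (⊕-cong ≈-refl
      (≈-trans (con-cong-⊗ (var T) (ℚₚ.neg-distribˡ-* N _)) (con-*-⊗ _ _ (var T))))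

  ∑-linear-shift : ∀ i (c : Subset (suc n) → ℚ) λ′ →
                   ∑ (λ T → con (c T ℚ.+ λ′ ℚ.* linearCoef i T) ⊗ var T) ≈ ∑ (λ T → con (c T) ⊗ var T)
  ∑-linear-shift i c λ′ = begin
    ∑ (λ T → con (c T ℚ.+ λ′ ℚ.* linearCoef i T) ⊗ var T)
      ≈⟨ ∑-cong split ⟩
    ∑ (λ T → con (c T) ⊗ var T ⊕ con λ′ ⊗ (con (linearCoef i T) ⊗ var T))
      ≈⟨ ∑-⊕ (λ T → con (c T) ⊗ var T) (λ T → con λ′ ⊗ (con (linearCoef i T) ⊗ var T)) ⟩
    ∑ (λ T → con (c T) ⊗ var T) ⊕ ∑ (λ T → con λ′ ⊗ (con (linearCoef i T) ⊗ var T))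
      ≈⟨ ⊕-cong ≈-refl (∑-distribˡ (con λ′) (λ T → con (linearCoef i T) ⊗ var T)) ⟨
    ∑ (λ T → con (c T) ⊗ var T) ⊕ con λ′ ⊗ ∑ (λ T → con (linearCoef i T) ⊗ var T)
      ≈⟨ ⊕-cong ≈-refl (≈-trans (⊗-cong ≈-refl (linear-relation i)) (zeroʳ _)) ⟩
    ∑ (λ T → con (c T) ⊗ var T) ⊕ con 0ℚ
      ≈⟨ +-identityʳ _ ⟩
    ∑ (λ T → con (c T) ⊗ var T) ∎
    where
    split : ∀ T → con (c T ℚ.+ λ′ ℚ.* linearCoef i T) ⊗ var T
                    ≈ con (c T) ⊗ var T ⊕ con λ′ ⊗ (con (linearCoef i T) ⊗ var T)
    split T = ≈-trans (con-+-⊗ _ _ (var T)) (⊕-cong ≈-refl (con-*-⊗ _ _ (var T)))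

  ∑-⊗-var-cong : ∀ F → IsNPFlat ⊤ r F → (c d : Subset (suc n) → ℚ) →
                 (∀ T → IsNPFlat ⊤ r T → T ⊆ F ⊎ F ⊆ T → c T ≡ d T) →
                 ∑ (λ T → con (c T) ⊗ var T) ⊗ var F ≈ ∑ (λ T → con (d T) ⊗ var T) ⊗ var F
  ∑-⊗-var-cong F flatF c d c≡d = begin
    ∑ (λ T → con (c T) ⊗ var T) ⊗ var F      ≈⟨ ∑-distribʳ (λ T → con (c T) ⊗ var T) (var F) ⟩
    ∑ (λ T → (con (c T) ⊗ var T) ⊗ var F)    ≈⟨ ∑-cong pointwise ⟩
    ∑ (λ T → (con (d T) ⊗ var T) ⊗ var F)    ≈⟨ ∑-distribʳ (λ T → con (d T) ⊗ var T) (var F) ⟨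
    ∑ (λ T → con (d T) ⊗ var T) ⊗ var F      ∎
    where
    both-vanish : ∀ T → var T ⊗ var F ≈ con 0ℚ →
                  (con (c T) ⊗ var T) ⊗ var F ≈ (con (d T) ⊗ var T) ⊗ var F
    both-vanish T xT⊗xF≈0 = ≈-trans (vanish (c T)) (≈-sym (vanish (d T)))
      where
      vanish : ∀ q → (con q ⊗ var T) ⊗ var F ≈ con 0ℚ
      vanish q = ≈-trans ⊗-assoc (≈-trans (⊗-cong ≈-refl xT⊗xF≈0) (zeroʳ _))

    pointwise : ∀ T → (con (c T) ⊗ var T) ⊗ var F ≈ (con (d T) ⊗ var T) ⊗ var F
    pointwise T with isNPFlat? ⊤ r T
    ... | no ¬flatT = both-vanish T (≈-trans (⊗-cong (rel (nonflat ¬flatT)) ≈-refl) (zeroˡ _))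
    ... | yes flatT with T Sub.⊆? F | F Sub.⊆? T
    ...   | yes T⊆F | _        = ≈-reflexive (cong (λ q → (con q ⊗ var T) ⊗ var F) (c≡d T flatT (inj₁ T⊆F)))
    ...   | no _    | yes F⊆T  = ≈-reflexive (cong (λ q → (con q ⊗ var T) ⊗ var F) (c≡d T flatT (inj₂ F⊆T)))
    ...   | no T⊈F  | no F⊈T   = both-vanish T (rel (incomp flatT flatF T⊈F F⊈T))

  linearCoef-∌ : ∀ i T → lookup T i ≡ false → linearCoef i T ≡ ι ∣ T ∣
  linearCoef-∌ i T eq rewrite eq =
    solve 2 (λ S N → S :- N :* con 0ℚ := S) refl (ι ∣ T ∣) (ι (suc n))
    where open +-*-Solver

  linearCoef-∋ : ∀ i T → lookup T i ≡ true → linearCoef i T ≡ ι (suc ∣ T - i ∣) ℚ.- ι (suc n)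
  linearCoef-∋ i T eq rewrite eq =
    cong₂ (λ s x → ι s ℚ.- x) (∣p∣≡1+∣p-x∣ i T eq) (ℚₚ.*-identityʳ (ι (suc n)))

-- The pullback along the deletion M ∖ i

module Pullback {u : ℕ} (M : Matroid (suc (suc u))) (i : Fin (suc (suc u))) where

  private
    n = suc u
    r = rank M
    U = ⊤ {suc n} - i

  open PresentedAlgebra (ChowRel ⊤ r)
  open ChowRing M

  ∣U∣≡n : ∣ U ∣ ≡ n
  ∣U∣≡n = ∣⊤-x∣≡n i

  flat-∌ : ∀ T → i ∉ T → IsNPFlat ⊤ r T → suc ∣ T ∣ ℕ.≤ n → IsNPFlat U r T
  flat-∌ T i∉T (nonempty , _ , (_ , closed)) ∣T∣<n =
    nonempty , proper , (T⊆U , λ x _ x∉T → closed x Sub.∈⊤ x∉T)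
    where
    T⊆U : T ⊆ U
    T⊆U x∈T = Sub.x∈p∧x≢y⇒x∈p-y Sub.∈⊤ λ { refl → i∉T x∈T }

    U⊈T : ¬ U ⊆ T
    U⊈T U⊆T = ℕₚ.<⇒≱ ∣T∣<n (subst (ℕ._≤ ∣ T ∣) ∣U∣≡n (Sub.p⊆q⇒∣p∣≤∣q∣ U⊆T))

    proper : ∃ λ x → x ∈ U × x ∉ T
    proper with any? (λ x → (x Sub.∈? U) ×-dec ¬? (x Sub.∈? T))
    ... | yes witness = witness
    ... | no ¬witness = ⊥-elim (U⊈T U⊆T)
      where
      U⊆T : U ⊆ T
      U⊆T {x} x∈U with x Sub.∈? T
      ... | yes x∈T = x∈T
      ... | no  x∉T = ⊥-elim (¬witness (x , x∈U , x∉T))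

  flat-∋ : ∀ T → i ∈ T → IsNPFlat ⊤ r T → Nonempty (T - i) → IsNPFlat U r (T - i)
  flat-∋ T i∈T (_ , (e , _ , e∉T) , (_ , closed)) nonempty =
    nonempty , (e , e∈U , λ e∈T-i → e∉T (T-i⊆T e∈T-i)) , (T-i⊆U , closed′)
    where
    T-i⊆T : T - i ⊆ T
    T-i⊆T = Sub.p─q⊆p T ⁅ i ⁆

    e∈U : e ∈ U
    e∈U = Sub.x∈p∧x≢y⇒x∈p-y Sub.∈⊤ λ { refl → e∉T i∈T }

    T-i⊆U : T - i ⊆ U
    T-i⊆U x∈T-i = Sub.x∈p∧x≢y⇒x∈p-y Sub.∈⊤ (x∈p-y⇒x≢y x∈T-i)

    closed′ : ∀ x → x ∈ U → x ∉ T - i → r (T - i) ℕ.< r ((T - i) ∪ ⁅ x ⁆)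
    closed′ x x∈U x∉T-i = rank-raise-⊆ M x T-i⊆T (closed x Sub.∈⊤ x∉T)
      where
      x∉T : x ∉ T
      x∉T x∈T = x∉T-i (Sub.x∈p∧x≢y⇒x∈p-y x∈T (x∈p-y⇒x≢y x∈U))

  deletionCoef : ℕ → Subset (suc n) → ℚ
  deletionCoef k S = if does (isNPFlat? U r S) then γ-coef U k S else 0ℚ

  pullbackCoef : ℕ → Subset (suc n) → ℚ
  pullbackCoef k T = if lookup T i then deletionCoef k (T - i) else deletionCoef k T

  deletionCoef-∋ : ∀ k S → lookup S i ≡ true → deletionCoef k S ≡ 0ℚ
  deletionCoef-∋ k S eq = go (isNPFlat? U r S) (S ⊆ᵇ U) (trans (⊆ᵇ-⊤-x i S) (cong not eq))
    where
    go : ∀ {A : Set} (d : Dec A) b → b ≡ false →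
         (if does d then (if b ∧ does (nonemptyProper? U S) then coef k ∣ S ∣ ∣ U ∣ else 0ℚ) else 0ℚ) ≡ 0ℚ
    go (yes _) false _ = refl
    go (no  _) _     _ = refl

  deletionCoef-∌ : ∀ k S → k ℕ.≤ n → lookup S i ≡ false →
                   (1 ℕ.≤ ∣ S ∣ → suc ∣ S ∣ ℕ.≤ n → IsNPFlat U r S) → deletionCoef k S ≡ coef k ∣ S ∣ n
  deletionCoef-∌ k S k≤n eq flat =
    go (isNPFlat? U r S) (S ⊆ᵇ U) (nonemptyProper? U S) (trans (⊆ᵇ-⊤-x i S) (cong not eq))
    where
    degenerate : ¬ (1 ℕ.≤ ∣ S ∣ × suc ∣ S ∣ ℕ.≤ n) → coef k ∣ S ∣ n ≡ 0ℚ
    degenerate = coef-degenerate k ∣ S ∣ n k≤n (x∉p⇒∣p∣≤n {p = S} (∉-lookup eq))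

    go : (d : Dec (IsNPFlat U r S)) (b : Bool) (e : Dec (1 ℕ.≤ ∣ S ∣ × suc ∣ S ∣ ℕ.≤ ∣ U ∣)) → b ≡ true →
         (if does d then (if b ∧ does e then coef k ∣ S ∣ ∣ U ∣ else 0ℚ) else 0ℚ) ≡ coef k ∣ S ∣ n
    go (yes _)    true (yes _)     _ = cong (coef k ∣ S ∣) ∣U∣≡n
    go (yes _)    true (no ¬sizes) _ =
      sym (degenerate λ (1≤s , s<n) → ¬sizes (1≤s , subst (suc ∣ S ∣ ℕ.≤_) (sym ∣U∣≡n) s<n))
    go (no ¬flat) _    _           _ = sym (degenerate λ (1≤s , s<n) → ¬flat (flat 1≤s s<n))

  pullbackCoef-∌ : ∀ k T → k ℕ.≤ n → lookup T i ≡ false → IsNPFlat ⊤ r T →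
                   pullbackCoef k T ≡ coef k ∣ T ∣ n
  pullbackCoef-∌ k T k≤n eq flatT rewrite eq =
    deletionCoef-∌ k T k≤n eq (λ _ ∣T∣<n → flat-∌ T (∉-lookup eq) flatT ∣T∣<n)

  pullbackCoef-∋ : ∀ k T → k ℕ.≤ n → lookup T i ≡ true → IsNPFlat ⊤ r T →
                   pullbackCoef k T ≡ coef k ∣ T - i ∣ n
  pullbackCoef-∋ k T k≤n eq flatT rewrite eq =
    deletionCoef-∌ k (T - i) k≤n (lookup[p-x]x≡false i T)
      (λ 1≤∣T-i∣ _ → flat-∋ T (∈-lookup eq) flatT (1≤∣p∣⇒Nonempty 1≤∣T-i∣))

  θ-generator : ∀ S → Dec (IsNPFlat U r S) → Expr (suc n)
  θ-generator S (yes _) = var S ⊕ var (S ∪ ⁅ i ⁆)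
  θ-generator S (no  _) = con 0ℚ

  θ-var≡θ-generator : ∀ S → θ ⊤ r i (var S) ≡ θ-generator S (isNPFlat? U r S)
  θ-var≡θ-generator S with isNPFlat? (⊤ ─ ⁅ i ⁆) r S
  ... | yes _ = refl
  ... | no  _ = refl

  con-⊗-θ-var : ∀ q S → con q ⊗ θ ⊤ r i (var S)
                          ≈ con (if does (isNPFlat? U r S) then q else 0ℚ) ⊗ (var S ⊕ var (S ∪ ⁅ i ⁆))
  con-⊗-θ-var q S = ≈-trans (⊗-cong ≈-refl (≈-reflexive (θ-var≡θ-generator S))) (go (isNPFlat? U r S))
    where
    go : (d : Dec (IsNPFlat U r S)) →
         con q ⊗ θ-generator S d ≈ con (if does d then q else 0ℚ) ⊗ (var S ⊕ var (S ∪ ⁅ i ⁆))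
    go (yes _) = ≈-refl
    go (no  _) = ≈-trans (zeroʳ _) (≈-sym (zeroˡ _))

  θγ-normalForm : ∀ k → k ℕ.≤ n → θ ⊤ r i (γ U (+ k)) ≈ ∑ (λ T → con (pullbackCoef k T) ⊗ var T)
  θγ-normalForm k k≤n = begin
    θ ⊤ r i (γ U (+ k))
      ≡⟨ θ-hypersimplexSum U ⊤ r i k (λ q S → con q ⊗ var S) ⟩
    hypersimplexSum U k (λ q S → con q ⊗ θ ⊤ r i (var S))
      ≈⟨ hypersimplexSum-≈ (ChowRel ⊤ r) U k (λ q S → con q ⊗ θ ⊤ r i (var S)) (λ S → zeroˡ _)
           (subst (k ℕ.≤_) (sym ∣U∣≡n) k≤n) ⟩
    ∑ (λ S → con (γ-coef U k S) ⊗ θ ⊤ r i (var S))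
      ≈⟨ ∑-cong (λ S → con-⊗-θ-var (γ-coef U k S) S) ⟩
    ∑ (λ S → con (deletionCoef k S) ⊗ (var S ⊕ var (S ∪ ⁅ i ⁆)))
      ≈⟨ ∑-⊗-var⊕var∪⁅x⁆ i (deletionCoef k) (deletionCoef-∋ k) ⟩
    ∑ (λ T → con (pullbackCoef k T) ⊗ var T) ∎
    where open ≈-Reasoning

  TruncationsAgree : ℕ → ℕ → Subset (suc n) → Set
  TruncationsAgree k k′ T =
    (lookup T i ≡ false → ∣ T ∣ ⊓ k ≡ ∣ T ∣ ⊓ k′) ×
    (lookup T i ≡ true → suc ∣ T - i ∣ ⊓ k′ ℕ.+ k ≡ ∣ T - i ∣ ⊓ k ℕ.+ k′)

  pullbackCoef≡γ-coef+shift : ∀ k k′ T → k ℕ.≤ n → IsNPFlat ⊤ r T → TruncationsAgree k k′ T →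
                              pullbackCoef k T ≡ γ-coef ⊤ k′ T ℚ.+ shift u k k′ ℚ.* linearCoef i T
  pullbackCoef≡γ-coef+shift k k′ T k≤n flatT (agree-∌ , agree-∋) = go (lookup T i) refl
    where
    open ≡-Reasoning
    s = ∣ T ∣
    g = ∣ T - i ∣

    go : ∀ b → lookup T i ≡ b → pullbackCoef k T ≡ γ-coef ⊤ k′ T ℚ.+ shift u k k′ ℚ.* linearCoef i T
    go false eq = begin
      pullbackCoef k T                                  ≡⟨ pullbackCoef-∌ k T k≤n eq flatT ⟩
      coef k s n                                        ≡⟨ coef-shift-∉ u k k′ s (agree-∌ eq) ⟩
      coef k′ s (suc n) ℚ.+ shift u k k′ ℚ.* ι s        ≡⟨ cong₂ (λ a b → a ℚ.+ shift u k k′ ℚ.* b)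
                                                             (γ-coef-flat k′ T flatT) (linearCoef-∌ i T eq) ⟨
      γ-coef ⊤ k′ T ℚ.+ shift u k k′ ℚ.* linearCoef i T ∎
    go true eq = begin
      pullbackCoef k T                                  ≡⟨ pullbackCoef-∋ k T k≤n eq flatT ⟩
      coef k g n                                        ≡⟨ coef-shift-∈ u k k′ g (agree-∋ eq) ⟩
      coef k′ (suc g) (suc n) ℚ.+ shift u k k′ ℚ.* (ι (suc g) ℚ.- ι (suc n))
        ≡⟨ cong₂ (λ a b → a ℚ.+ shift u k k′ ℚ.* b)
             (trans (γ-coef-flat k′ T flatT) (cong (λ s → coef k′ s (suc n)) (∣p∣≡1+∣p-x∣ i T eq)))
             (linearCoef-∋ i T eq) ⟨
      γ-coef ⊤ k′ T ℚ.+ shift u k k′ ℚ.* linearCoef i T ∎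

  truncationsAgree-∉F : ∀ {F} k T → i ∉ F → k ℕ.≤ ∣ F ∣ → T ⊆ F ⊎ F ⊆ T → TruncationsAgree k k T
  truncationsAgree-∉F {F} k T i∉F k≤∣F∣ comparable = (λ _ → refl) , λ eq →
    let k≤g = ℕₚ.≤-trans k≤∣F∣ (Sub.p⊆q⇒∣p∣≤∣q∣ (F⊆T-i eq)) in
    cong (ℕ._+ k) (trans (ℕₚ.m≥n⇒m⊓n≡n (ℕₚ.m≤n⇒m≤1+n k≤g)) (sym (ℕₚ.m≥n⇒m⊓n≡n k≤g)))
    where
    F⊆T : lookup T i ≡ true → F ⊆ T
    F⊆T eq = [ (λ T⊆F → ⊥-elim (i∉F (T⊆F (∈-lookup eq)))) , (λ F⊆T → F⊆T) ]′ comparable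

    F⊆T-i : lookup T i ≡ true → F ⊆ T - i
    F⊆T-i eq x∈F = Sub.x∈p∧x≢y⇒x∈p-y (F⊆T eq x∈F) λ { refl → i∉F x∈F }

  truncationsAgree-∈F : ∀ {F} k T → i ∈ F → ∣ F ∣ ℕ.≤ suc k → T ⊆ F ⊎ F ⊆ T →
                        TruncationsAgree k (suc k) T
  truncationsAgree-∈F {F} k T i∈F ∣F∣≤1+k comparable =
    (λ eq → trans (ℕₚ.m≤n⇒m⊓n≡m (∣T∣≤k eq)) (sym (ℕₚ.m≤n⇒m⊓n≡m (ℕₚ.m≤n⇒m≤1+n (∣T∣≤k eq))))) ,
    (λ _ → sym (ℕₚ.+-suc (∣ T - i ∣ ⊓ k) k))
    where
    T⊆F : lookup T i ≡ false → T ⊆ F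
    T⊆F eq = [ (λ T⊆F → T⊆F) , (λ F⊆T → ⊥-elim (∉-lookup eq (F⊆T i∈F))) ]′ comparable

    T⊆F-i : lookup T i ≡ false → T ⊆ F - i
    T⊆F-i eq x∈T = Sub.x∈p∧x≢y⇒x∈p-y (T⊆F eq x∈T) λ { refl → ∉-lookup eq x∈T }

    ∣T∣≤k : lookup T i ≡ false → ∣ T ∣ ℕ.≤ k
    ∣T∣≤k eq = ℕₚ.≤-pred (ℕₚ.≤-trans (s≤s (Sub.p⊆q⇒∣p∣≤∣q∣ (T⊆F-i eq)))
      (subst (ℕ._≤ suc k) (∣p∣≡1+∣p-x∣ i F (lookup-∈ i∈F)) ∣F∣≤1+k))

  θγ⊗var≈γ⊗var : ∀ F → IsNPFlat ⊤ r F → ∀ k k′ → k ℕ.≤ n → k′ ℕ.≤ suc n →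
                 (∀ T → T ⊆ F ⊎ F ⊆ T → TruncationsAgree k k′ T) →
                 θ ⊤ r i (γ U (+ k)) ⊗ var F ≈ γ ⊤ (+ k′) ⊗ var F
  θγ⊗var≈γ⊗var F flatF k k′ k≤n k′≤1+n agree = begin
    θ ⊤ r i (γ U (+ k)) ⊗ var F
      ≈⟨ ⊗-cong (θγ-normalForm k k≤n) ≈-refl ⟩
    ∑ (λ T → con (pullbackCoef k T) ⊗ var T) ⊗ var F
      ≈⟨ ∑-⊗-var-cong F flatF (pullbackCoef k) (λ T → γ-coef ⊤ k′ T ℚ.+ shift u k k′ ℚ.* linearCoef i T)
           (λ T flatT comparable → pullbackCoef≡γ-coef+shift k k′ T k≤n flatT (agree T comparable)) ⟩
    ∑ (λ T → con (γ-coef ⊤ k′ T ℚ.+ shift u k k′ ℚ.* linearCoef i T) ⊗ var T) ⊗ var F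
      ≈⟨ ⊗-cong (∑-linear-shift i (γ-coef ⊤ k′) (shift u k k′)) ≈-refl ⟩
    ∑ (λ T → con (γ-coef ⊤ k′ T) ⊗ var T) ⊗ var F
      ≈⟨ ⊗-cong (γ-normalForm k′ k′≤1+n) ≈-refl ⟨
    γ ⊤ (+ k′) ⊗ var F ∎
    where open ≈-Reasoning

  θγ⊗var-out-of-range : ∀ F k → ¬ k ℕ.≤ n → θ ⊤ r i (γ U (+ k)) ⊗ var F ≈ γ ⊤ (+ suc k) ⊗ var F
  θγ⊗var-out-of-range F k k≰n = ≈-reflexive (trans
    (cong (λ x → θ ⊤ r i x ⊗ var F) (γ-out-of-range U k 1+k≰∣U∣))
    (cong (_⊗ var F) (sym (γ-out-of-range ⊤ (suc k) 2+k≰∣⊤∣))))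
    where
    1+k≰∣U∣ : ¬ suc k ℕ.≤ ∣ U ∣
    1+k≰∣U∣ 1+k≤∣U∣ = k≰n (ℕₚ.≤-trans (ℕₚ.n≤1+n k) (subst (suc k ℕ.≤_) ∣U∣≡n 1+k≤∣U∣))

    2+k≰∣⊤∣ : ¬ suc (suc k) ℕ.≤ ∣ ⊤ {suc n} ∣
    2+k≰∣⊤∣ 2+k≤∣⊤∣ =
      k≰n (ℕₚ.≤-trans (ℕₚ.n≤1+n k) (ℕₚ.≤-pred (subst (suc (suc k) ℕ.≤_) (Sub.∣⊤∣≡n (suc n)) 2+k≤∣⊤∣)))

lemma3p7 : (n : ℕ) (M : Matroid (suc n)) → Loopless M →
           (i : Fin (suc n)) (ℓ : ℤ) (F : Subset (suc n)) →
           IsNPFlat ⊤ (rank M) F →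
           ((+ ∣ F ∣ ℤ.≤ ℓ → i ∈ F →
             θ ⊤ (rank M) i (γ (⊤ ─ ⁅ i ⁆) (ℓ ℤ.- ℤ.1ℤ)) ⊗ var F
               ≈A⟨ ⊤ , rank M ⟩ γ ⊤ ℓ ⊗ var F)
           × (ℓ ℤ.≤ + ∣ F ∣ → i ∉ F →
             θ ⊤ (rank M) i (γ (⊤ ─ ⁅ i ⁆) ℓ) ⊗ var F
               ≈A⟨ ⊤ , rank M ⟩ γ ⊤ ℓ ⊗ var F))
lemma3p7 zero    M _ i ℓ F ((zero , zero∈F) , (zero , _ , zero∉F) , _) = ⊥-elim (zero∉F zero∈F)
lemma3p7 (suc u) M _ i ℓ F flatF@(nonempty , (e , _ , e∉F) , _) = part₁ ℓ , part₂ ℓ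
  where
  open PresentedAlgebra (ChowRel ⊤ (rank M)) using (_≈_)
  open Pullback M i

  part₁ : ∀ ℓ → + ∣ F ∣ ℤ.≤ ℓ → i ∈ F → θ ⊤ (rank M) i (γ (⊤ - i) (ℓ ℤ.- ℤ.1ℤ)) ⊗ var F ≈ γ ⊤ ℓ ⊗ var F
  part₁ -[1+ _ ] ()              _
  part₁ (+ zero)  (ℤ.+≤+ ∣F∣≤0) _ = ⊥-elim (ℕₚ.<⇒≱ (Nonempty⇒1≤∣p∣ nonempty) ∣F∣≤0)
  part₁ (+ suc k) (ℤ.+≤+ ∣F∣≤1+k) i∈F with k ℕₚ.≤? suc u
  ... | yes k≤n = θγ⊗var≈γ⊗var F flatF k (suc k) k≤n (s≤s k≤n) λ T → truncationsAgree-∈F k T i∈F ∣F∣≤1+k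
  ... | no  k≰n = θγ⊗var-out-of-range F k k≰n

  part₂ : ∀ ℓ → ℓ ℤ.≤ + ∣ F ∣ → i ∉ F → θ ⊤ (rank M) i (γ (⊤ - i) ℓ) ⊗ var F ≈ γ ⊤ ℓ ⊗ var F
  part₂ -[1+ _ ] _               _   = ≈-refl
  part₂ (+ k)    (ℤ.+≤+ k≤∣F∣) i∉F =
    θγ⊗var≈γ⊗var F flatF k k k≤n (ℕₚ.m≤n⇒m≤1+n k≤n) λ T → truncationsAgree-∉F k T i∉F k≤∣F∣
    where k≤n = ℕₚ.≤-trans k≤∣F∣ (x∉p⇒∣p∣≤n e∉F)
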